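{- The system $\mathbf{Mp}^-$ is incomplete: some valid formula is not derivable in it.
   Context: Formulas are built from literals, namely propositional variables $P$ and their complements $\bar P$, using $\wedge$ and $\vee$. Negation satisfies $\neg P=\bar P$ and $\neg\bar P=P$, and is extended by De Morgan's laws. A sequent is a nonempty finite multiset of formulas, and $\Gamma,\Delta,\Sigma$ denote possibly empty multisets. A formula is valid if it evaluates to $1$ under every $0/1$-assignment, with $\bar P$ read as the complement of $P$. The system $\mathbf{Mp}^-$ has the following rules: - Axiom: infer $P,\neg P$ from no premises. - $(\&)$: from $\Gamma,A$ and $\Gamma,B$ infer $\Gamma,A\wedge B$. - $(\otimes)$: from $\Delta,A$ and $\Sigma,B$ infer $\Delta,\Sigma,A\wedge B$. - $(\mathrm{par})$: from $\Gamma,A,B$ infer $\Gamma,A\vee B$. - $(\oplus_i)$ for $i=1,2$: from $\Gamma,A_i$ infer $\Gamma,A_1\vee A_2$. The system is complete if every valid formula, viewed as a one-element sequent, is derivable. -}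

module Defs where

open import Data.Nat using (ℕ)
open import Data.Bool using (Bool; true; false; not; _∧_; _∨_)
open import Data.List using (List; []; _∷_; _++_; [_])
open import Data.List.Relation.Binary.Permutation.Propositional using (_↭_)
open import Relation.Binary.PropositionalEquality using (_≡_)

data Formula : Set where
  pos  : ℕ → Formula
  neg  : ℕ → Formula
  _∧̂_ : Formula → Formula → Formula
  _∨̂_ : Formula → Formula → Formula

infixr 6 _∧̂_
infixr 5 _∨̂_

¬̂ : Formula → Formula
¬̂ (pos n)  = neg n
¬̂ (neg n)  = pos n
¬̂ (A ∧̂ B) = ¬̂ A ∨̂ ¬̂ B
¬̂ (A ∨̂ B) = ¬̂ A ∧̂ ¬̂ B

eval : (ℕ → Bool) → Formula → Bool
eval ρ (pos n)  = ρ n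
eval ρ (neg n)  = not (ρ n)
eval ρ (A ∧̂ B) = eval ρ A ∧ eval ρ B
eval ρ (A ∨̂ B) = eval ρ A ∨ eval ρ B

Valid : Formula → Set
Valid A = ∀ (ρ : ℕ → Bool) → eval ρ A ≡ true

-- Sequents are finite multisets, represented as lists taken up to permutation
-- (rule `perm`). Every conclusion of a rule below is nonempty.
data Mp⁻ : List Formula → Set where
  perm : ∀ {Γ Γ'} → Γ ↭ Γ' → Mp⁻ Γ → Mp⁻ Γ'
  ax   : ∀ (P : ℕ) → Mp⁻ (pos P ∷ ¬̂ (pos P) ∷ [])
  with& : ∀ {Γ A B} → Mp⁻ (Γ ++ [ A ]) → Mp⁻ (Γ ++ [ B ]) → Mp⁻ (Γ ++ [ A ∧̂ B ])
  tensor : ∀ {Δ Σ A B} → Mp⁻ (Δ ++ [ A ]) → Mp⁻ (Σ ++ [ B ])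
         → Mp⁻ (Δ ++ Σ ++ [ A ∧̂ B ])
  par  : ∀ {Γ A B} → Mp⁻ (Γ ++ A ∷ B ∷ []) → Mp⁻ (Γ ++ [ A ∨̂ B ])
  plus₁ : ∀ {Γ A B} → Mp⁻ (Γ ++ [ A ]) → Mp⁻ (Γ ++ [ A ∨̂ B ])
  plus₂ : ∀ {Γ A B} → Mp⁻ (Γ ++ [ B ]) → Mp⁻ (Γ ++ [ A ∨̂ B ])

Complete : Set
Complete = ∀ (A : Formula) → Valid A → Mp⁻ [ A ]

-- The formula p̄ ∨ (p ∧ q) ∨ (p ∧ q̄) is valid, but a derivation of it has to use
-- p̄ twice, once for each disjunct, and Mp⁻ has no contraction. Searching backwards,
-- every sequent reached is invalid, is p̄, (p ∧ q) ∨ (p ∧ q̄), or has the form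
-- p̄, X, Y with X and Y among p, p ∧ q, p ∧ q̄. No rule ends in such a sequent: & and ⊗ act on a
-- conjunct X = p ∧ ℓ; & leads to p̄, Y, p of the same form, while ⊗ would split
-- the context p̄, Y so that both halves are true under an assignment falsifying p
-- and ℓ, although only p̄ is true there.
module Submission where

open import Defs
open import Data.Bool using (Bool; true; false; not; T; T?)
open import Data.Bool.Properties using (T-∧; T-∨)
open import Data.Empty using (⊥; ⊥-elim)
open import Data.List using (List; []; _∷_; _++_; [_]; filter; length)
open import Data.List.Membership.Propositional using (_∈_; _─_)
open import Data.List.Properties using (++-assoc; filter-++; filter-some; length-++)
open import Data.List.Relation.Binary.Permutation.Propositional
  using (_↭_; ↭-refl; ↭-prep; ↭-swap; ↭-trans; ↭-sym; ↭-reflexive)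
open import Data.List.Relation.Binary.Permutation.Propositional.Properties
  using (Any-resp-↭; ∈-resp-↭; ↭-length; drop-∷; ∷↭∷ʳ; ++⁺ʳ; filter-↭)
open import Data.List.Relation.Unary.Any using (Any; here; there)
import Data.List.Relation.Unary.Any.Properties as Any
open import Data.Nat using (ℕ; zero; suc; _≤_; _+_; s≤s)
open import Data.Nat.Properties using (+-mono-≤)
open import Data.Product using (Σ-syntax; ∃-syntax; _×_; _,_; proj₁)
open import Data.Sum using (_⊎_; inj₁; inj₂)
open import Function using (_∘_)
open import Function.Bundles using (Equivalence)
open import Relation.Binary.PropositionalEquality using (_≡_; refl; sym; trans; cong; subst)
open import Relation.Nullary using (¬_)

private
  variable
    ρ : ℕ → Bool
    x : Formula
    xs Γ Δ Σ Θ : List Formula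
    A B C X Y : Formula

Holds : (ℕ → Bool) → List Formula → Set
Holds ρ = Any (T ∘ eval ρ)

Holds-∷ʳ⁻ : Holds ρ (Γ ++ [ A ]) → Holds ρ Γ ⊎ T (eval ρ A)
Holds-∷ʳ⁻ {Γ = Γ} h with Any.++⁻ Γ h
... | inj₁ γ        = inj₁ γ
... | inj₂ (here a) = inj₂ a

Holds-∷ʳ-mono : (T (eval ρ A) → T (eval ρ C)) → Holds ρ (Γ ++ [ A ]) → Holds ρ (Γ ++ [ C ])
Holds-∷ʳ-mono {Γ = Γ} f h with Holds-∷ʳ⁻ h
... | inj₁ γ = Any.++⁺ˡ γ
... | inj₂ a = Any.++⁺ʳ Γ (here (f a))

Holds-∷ʳ-false : ¬ T (eval ρ A) → Holds ρ (Γ ++ [ A ]) → Holds ρ Γ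
Holds-∷ʳ-false f h with Holds-∷ʳ⁻ h
... | inj₁ γ = γ
... | inj₂ a = ⊥-elim (f a)

T-excluded-middle : ∀ b → T b ⊎ T (not b)
T-excluded-middle true  = inj₁ _
T-excluded-middle false = inj₂ _

sound : Mp⁻ Γ → ∀ ρ → Holds ρ Γ
sound (perm σ d) ρ = Any-resp-↭ σ (sound d ρ)
sound (ax P) ρ with T-excluded-middle (ρ P)
... | inj₁ t = here t
... | inj₂ f = there (here f)
sound (with& d₁ d₂) ρ with Holds-∷ʳ⁻ (sound d₁ ρ)
... | inj₁ γ = Any.++⁺ˡ γ
... | inj₂ a = Holds-∷ʳ-mono (λ b → Equivalence.from T-∧ (a , b)) (sound d₂ ρ)
sound (tensor {Δ} d₁ d₂) ρ with Holds-∷ʳ⁻ (sound d₁ ρ)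
... | inj₁ δ = Any.++⁺ˡ δ
... | inj₂ a = Any.++⁺ʳ Δ (Holds-∷ʳ-mono (λ b → Equivalence.from T-∧ (a , b)) (sound d₂ ρ))
sound (par {Γ} d) ρ with Any.++⁻ Γ (sound d ρ)
... | inj₁ γ                = Any.++⁺ˡ γ
... | inj₂ (here a)         = Any.++⁺ʳ Γ (here (Equivalence.from T-∨ (inj₁ a)))
... | inj₂ (there (here b)) = Any.++⁺ʳ Γ (here (Equivalence.from T-∨ (inj₂ b)))
sound (plus₁ d) ρ = Holds-∷ʳ-mono (Equivalence.from T-∨ ∘ inj₁) (sound d ρ)
sound (plus₂ d) ρ = Holds-∷ʳ-mono (Equivalence.from T-∨ ∘ inj₂) (sound d ρ)

↭-∷-─ : (m : x ∈ xs) → xs ↭ x ∷ (xs ─ m)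
↭-∷-─ (here refl)            = ↭-refl
↭-∷-─ {xs = y ∷ _} (there m) = ↭-trans (↭-prep y (↭-∷-─ m)) (↭-swap y _ ↭-refl)

∷ʳ-↭-inv : Γ ++ [ C ] ↭ Θ → Σ[ m ∈ C ∈ Θ ] Γ ↭ Θ ─ m
∷ʳ-↭-inv {Γ} {C} τ = m , drop-∷ (↭-trans (∷↭∷ʳ C Γ) (↭-trans τ (↭-∷-─ m)))
  where
  m : C ∈ _
  m = ∈-resp-↭ τ (Any.++⁺ʳ Γ (here refl))

↭-reassocˡ : ∀ Δ → Δ ++ Σ ++ [ C ] ↭ Θ → (Δ ++ Σ) ++ [ C ] ↭ Θ
↭-reassocˡ Δ = ↭-trans (↭-reflexive (++-assoc Δ _ _))

trueCount : (ℕ → Bool) → List Formula → ℕ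
trueCount ρ Γ = length (filter (T? ∘ eval ρ) Γ)

trueCount-↭ : Γ ↭ Θ → trueCount ρ Γ ≡ trueCount ρ Θ
trueCount-↭ σ = ↭-length (filter-↭ _ σ)

trueCount-++ : ∀ Δ → trueCount ρ (Δ ++ Σ) ≡ trueCount ρ Δ + trueCount ρ Σ
trueCount-++ {ρ} {Σ} Δ = trans (cong length (filter-++ (T? ∘ eval ρ) Δ Σ)) (length-++ (filter _ Δ))

split-trueCount : Δ ++ Σ ↭ Θ → Holds ρ Δ → Holds ρ Σ → 2 ≤ trueCount ρ Θ
split-trueCount {Δ} {ρ = ρ} σ hΔ hΣ =
  subst (2 ≤_) (trans (sym (trueCount-++ Δ)) (trueCount-↭ σ))
    (+-mono-≤ (filter-some (T? ∘ eval ρ) hΔ) (filter-some (T? ∘ eval ρ) hΣ))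

p q p̄ q̄ : Formula
p = pos 0
q = pos 1
p̄ = neg 0
q̄ = neg 1

q̂ : Bool → Formula
q̂ false = q
q̂ true  = q̄

assign : Bool → Bool → ℕ → Bool
assign a b zero    = a
assign a b (suc _) = b

data PHeaded : Formula → Set where
  p-itself : PHeaded p
  p∧q̂      : ∀ b → PHeaded (p ∧̂ q̂ b)

q̂-false : ∀ b → ¬ T (eval (assign false b) (q̂ b))
q̂-false false ()
q̂-false true  ()

p̄-only-true : ∀ b → PHeaded Y → trueCount (assign false b) (p̄ ∷ Y ∷ []) ≡ 1
p̄-only-true b p-itself  = refl
p̄-only-true b (p∧q̂ b′) = refl

∨∉p̄-PHeaded : PHeaded X → PHeaded Y → ¬ (A ∨̂ B ∈ p̄ ∷ X ∷ Y ∷ [])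
∨∉p̄-PHeaded () hY (there (here refl))
∨∉p̄-PHeaded hX () (there (there (here refl)))

∧-last-p̄-PHeaded : PHeaded X → PHeaded Y → Γ ++ [ A ∧̂ B ] ↭ p̄ ∷ X ∷ Y ∷ []
                 → ∃[ Z ] (PHeaded Z × PHeaded (A ∧̂ B) × Γ ↭ p̄ ∷ Z ∷ [])
∧-last-p̄-PHeaded hX hY τ with ∷ʳ-↭-inv τ
... | there (here refl)         , σ = _ , hY , hX , σ
... | there (there (here refl)) , σ = _ , hX , hY , σ

p̄-PHeaded-unsplittable : ∀ b → PHeaded Y → Δ ++ Σ ↭ p̄ ∷ Y ∷ []
                       → Holds (assign false b) Δ → Holds (assign false b) Σ → ⊥
p̄-PHeaded-unsplittable b hY σ hΔ hΣ with subst (2 ≤_) (p̄-only-true b hY) (split-trueCount σ hΔ hΣ)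
... | s≤s ()

p̄-PHeaded-underivable : PHeaded X → PHeaded Y → Mp⁻ Γ → Γ ↭ p̄ ∷ X ∷ Y ∷ [] → ⊥
p̄-PHeaded-underivable hX hY (perm σ d) τ = p̄-PHeaded-underivable hX hY d (↭-trans σ τ)
p̄-PHeaded-underivable hX hY (ax P) τ with ↭-length τ
... | ()
p̄-PHeaded-underivable hX hY (with& d₁ d₂) τ with ∧-last-p̄-PHeaded hX hY τ
... | _ , hZ , p∧q̂ b , σ = p̄-PHeaded-underivable hZ p-itself d₁ (++⁺ʳ [ p ] σ)
p̄-PHeaded-underivable hX hY (tensor {Δ} d₁ d₂) τ
  with ∧-last-p̄-PHeaded hX hY (↭-reassocˡ Δ τ)
... | _ , hZ , p∧q̂ b , σ = p̄-PHeaded-unsplittable b hZ σ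
  (Holds-∷ʳ-false (λ ()) (sound d₁ _)) (Holds-∷ʳ-false (q̂-false b) (sound d₂ _))
p̄-PHeaded-underivable hX hY (par d) τ = ∨∉p̄-PHeaded hX hY (proj₁ (∷ʳ-↭-inv τ))
p̄-PHeaded-underivable hX hY (plus₁ d) τ = ∨∉p̄-PHeaded hX hY (proj₁ (∷ʳ-↭-inv τ))
p̄-PHeaded-underivable hX hY (plus₂ d) τ = ∨∉p̄-PHeaded hX hY (proj₁ (∷ʳ-↭-inv τ))

p∧q∨p∧q̄ : Formula
p∧q∨p∧q̄ = (p ∧̂ q) ∨̂ (p ∧̂ q̄)

p̄∨p∧q∨p∧q̄ : Formula
p̄∨p∧q∨p∧q̄ = p̄ ∨̂ p∧q∨p∧q̄

p̄∨p∧q∨p∧q̄-valid : Valid p̄∨p∧q∨p∧q̄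
p̄∨p∧q∨p∧q̄-valid ρ with ρ 0 | ρ 1
... | false | _     = refl
... | true  | true  = refl
... | true  | false = refl

p̄,p∧q∨p∧q̄-underivable : Mp⁻ Γ → Γ ↭ p̄ ∷ p∧q∨p∧q̄ ∷ [] → ⊥
p̄,p∧q∨p∧q̄-underivable (perm σ d) τ = p̄,p∧q∨p∧q̄-underivable d (↭-trans σ τ)
p̄,p∧q∨p∧q̄-underivable (ax P) τ with ∈-resp-↭ (↭-sym τ) (there (here refl))
... | here ()
... | there (here ())
p̄,p∧q∨p∧q̄-underivable (with& d₁ d₂) τ with ∷ʳ-↭-inv τ
... | there (here ()) , _
p̄,p∧q∨p∧q̄-underivable (tensor {Δ} d₁ d₂) τ
  with ∷ʳ-↭-inv (↭-reassocˡ Δ τ)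
... | there (here ()) , _
p̄,p∧q∨p∧q̄-underivable (par d) τ with ∷ʳ-↭-inv τ
... | there (here refl) , σ =
  p̄-PHeaded-underivable (p∧q̂ false) (p∧q̂ true) d (++⁺ʳ (p ∧̂ q ∷ p ∧̂ q̄ ∷ []) σ)
p̄,p∧q∨p∧q̄-underivable (plus₁ d) τ with ∷ʳ-↭-inv τ
... | there (here refl) , σ with sound (perm (++⁺ʳ [ p ∧̂ q ] σ) d) (assign true false)
... | there (here ())
p̄,p∧q∨p∧q̄-underivable (plus₂ d) τ with ∷ʳ-↭-inv τ
... | there (here refl) , σ with sound (perm (++⁺ʳ [ p ∧̂ q̄ ] σ) d) (assign true true)
... | there (here ())

p̄∨p∧q∨p∧q̄-underivable : Mp⁻ Γ → Γ ↭ [ p̄∨p∧q∨p∧q̄ ] → ⊥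
p̄∨p∧q∨p∧q̄-underivable (perm σ d) τ = p̄∨p∧q∨p∧q̄-underivable d (↭-trans σ τ)
p̄∨p∧q∨p∧q̄-underivable (ax P) τ with ↭-length τ
... | ()
p̄∨p∧q∨p∧q̄-underivable (with& d₁ d₂) τ with ∷ʳ-↭-inv τ
... | here () , _
p̄∨p∧q∨p∧q̄-underivable (tensor {Δ} d₁ d₂) τ
  with ∷ʳ-↭-inv (↭-reassocˡ Δ τ)
... | here () , _
p̄∨p∧q∨p∧q̄-underivable (par d) τ with ∷ʳ-↭-inv τ
... | here refl , σ = p̄,p∧q∨p∧q̄-underivable d (++⁺ʳ (p̄ ∷ p∧q∨p∧q̄ ∷ []) σ)
p̄∨p∧q∨p∧q̄-underivable (plus₁ d) τ with ∷ʳ-↭-inv τ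
... | here refl , σ with sound (perm (++⁺ʳ [ p̄ ] σ) d) (assign true true)
... | here ()
p̄∨p∧q∨p∧q̄-underivable (plus₂ d) τ with ∷ʳ-↭-inv τ
... | here refl , σ with sound (perm (++⁺ʳ [ p∧q∨p∧q̄ ] σ) d) (assign false false)
... | here ()

proposition8 : ∃[ A ] (Valid A × ¬ Mp⁻ [ A ])
proposition8 =
  p̄∨p∧q∨p∧q̄ , p̄∨p∧q∨p∧q̄-valid , λ d → p̄∨p∧q∨p∧q̄-underivable d ↭-refl
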